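{- Let $n\ge 1$, let $X=\{0,1\}^n$, let $C$ be the family of cylinders in $X$, and let $\mu$ be the uniform distribution on $X$. Then every weak $\frac14$-net for $C$ over $\mu$ has size at least $\log_2 n$.
   Context: A set $c\subseteq\{0,1\}^n$ is a cylinder if there are $Y\subseteq[n]$ and $v\in\{0,1\}^Y$ such that $c=\{u\in\{0,1\}^n: u|_Y=v\}$. A set $S\subseteq X$ is a weak $\varepsilon$-net for $C$ over $\mu$ if $S\cap c\neq\emptyset$ for every $c\in C$ with $\mu(c)\ge\varepsilon$. -}

module Defs where

open import Data.Nat using (ℕ; zero; suc)
open import Data.Bool using (Bool; true; false)
open import Data.Vec using (Vec; []; _∷_; lookup)
open import Data.List using (List; []; _∷_; _++_; map; length; filter)
open import Data.Fin using (Fin)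
open import Data.Fin.Subset using (Subset; _∈_)
open import Data.Fin.Subset.Properties using (_∈?_)
open import Data.Fin.Properties using (all?)
open import Data.Bool.Properties using () renaming (_≟_ to _≟ᵇ_)
open import Relation.Binary.PropositionalEquality using (_≡_)
open import Relation.Nullary using (Dec; yes; no)
open import Relation.Nullary.Decidable using (_→-dec_)

-- The cube X = {0,1}^n, points are boolean vectors (false = 0, true = 1).
Cube : ℕ → Set
Cube n = Vec Bool n

allPoints : (n : ℕ) → List (Cube n)
allPoints zero = [] ∷ []
allPoints (suc n) = map (false ∷_) (allPoints n) ++ map (true ∷_) (allPoints n)

-- The cylinder c(Y,v) = { u ∈ {0,1}^n | u|_Y = v|_Y }, for Y ⊆ [n] and
-- v ∈ {0,1}^n (only the coordinates of v in Y matter, so this ranges over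
-- exactly the cylinders of the paper).
InCylinder : {n : ℕ} → Subset n → Cube n → Cube n → Set
InCylinder {n} Y v u = (i : Fin n) → i ∈ Y → lookup u i ≡ lookup v i

inCylinder? : {n : ℕ} (Y : Subset n) (v u : Cube n) → Dec (InCylinder Y v u)
inCylinder? Y v u = all? (λ i → (i ∈? Y) →-dec (lookup u i ≟ᵇ lookup v i))

-- |c(Y,v)|: number of points of the cube in the cylinder.
-- Under the uniform distribution, μ(c(Y,v)) = cylSize Y v / 2^n.
cylSize : {n : ℕ} → Subset n → Cube n → ℕ
cylSize {n} Y v = length (filter (inCylinder? Y v) (allPoints n))

-- Weak 1/4-net for the cylinders over the uniform distribution:
-- S meets every cylinder c with μ(c) = |c|/2^n ≥ 1/4, i.e. 4·|c| ≥ 2^n.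
open import Data.Nat using (_*_; _^_; _≤_)
open import Data.List.Relation.Unary.Any using (Any)

WeakQuarterNet : (n : ℕ) → List (Cube n) → Set
WeakQuarterNet n S =
  (Y : Subset n) (v : Cube n) → 2 ^ n ≤ 4 * cylSize Y v → Any (InCylinder Y v) S

-- If n > 2^|S|, two of the n coordinate columns of S (each a word of length
-- |S|) coincide by pigeonhole, say at coordinates i ≠ j.  Then S misses the
-- cylinder {u | u_i = 0, u_j = 1}, whose measure is 1/4.
module Submission where

open import Defs
open import Algebra.Properties.CommutativeSemigroup using (x∙yz≈y∙xz)
open import Data.Bool using (Bool; true; false)
open import Data.Empty using (⊥-elim)
open import Data.Fin as Fin using (Fin; funToFin; finToFun)
open import Data.Fin.Properties using (pigeonhole; finToFun-funToFin; 2↔Bool) renaming (<⇒≢ to <⇒≢ᶠ)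
open import Data.Fin.Subset using (Subset; ⁅_⁆; _∪_; ∣_∣)
open import Data.Fin.Subset.Properties using (x∈⁅x⁆; x∈⁅y⁆⇒x≡y; ∣⁅x⁆∣≡1; x∈p∪q⁺)
open import Data.List as List using (List; length; _++_; map; filter)
open import Data.List.Properties using (filter-++; length-++)
open import Data.List.Relation.Binary.Sublist.Heterogeneous.Properties
  using (⊆-filter-Sublist; length-mono-≤)
open import Data.List.Relation.Binary.Sublist.Propositional using (⊆-refl)
open import Data.List.Relation.Unary.Any as Any using (Any)
open import Data.List.Relation.Unary.Any.Properties using (lookup-result)
open import Data.List.Relation.Unary.Unique.Propositional using (Unique)
open import Data.Nat using (ℕ; suc; s≤s; _≤_; _^_; _+_; _*_; _≤?_)
open import Data.Nat.Properties
open import Data.Product using (_,_)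
open import Data.Sum using (inj₁; inj₂)
open import Data.Vec using ([]; _∷_; here; there; lookup)
open import Data.Vec.Properties using ([]=⇒lookup; lookup⇒[]=)
open import Function using (_∘_; Inverse)
open import Level using (0ℓ)
open import Relation.Binary.PropositionalEquality
open import Relation.Nullary using (yes; no)
open import Relation.Unary using (Pred; Decidable)

private
  variable
    A B : Set
    n : ℕ

length-filter-++ : {P : Pred A 0ℓ} (P? : Decidable P) (xs ys : List A) →
  length (filter P? (xs ++ ys)) ≡ length (filter P? xs) + length (filter P? ys)
length-filter-++ P? xs ys = trans (cong length (filter-++ P? xs ys)) (length-++ (filter P? xs))

length-filter-map : {P : Pred B 0ℓ} (P? : Decidable P) (f : A → B) (xs : List A) →
  length (filter P? (map f xs)) ≡ length (filter (P? ∘ f) xs)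
length-filter-map P? f List.[] = refl
length-filter-map P? f (x List.∷ xs) with P? (f x)
... | yes _ = cong suc (length-filter-map P? f xs)
... | no _  = length-filter-map P? f xs

length-filter-mono : {P Q : Pred A 0ℓ} (P? : Decidable P) (Q? : Decidable Q) →
  (∀ {x} → P x → Q x) → (xs : List A) →
  length (filter P? xs) ≤ length (filter Q? xs)
length-filter-mono P? Q? P⇒Q xs =
  length-mono-≤ (⊆-filter-Sublist P? Q? (λ { refl → P⇒Q }) (⊆-refl {x = xs}))

∣p∪q∣≤∣p∣+∣q∣ : (p q : Subset n) → ∣ p ∪ q ∣ ≤ ∣ p ∣ + ∣ q ∣
∣p∪q∣≤∣p∣+∣q∣ [] [] = ≤-refl
∣p∪q∣≤∣p∣+∣q∣ (true  ∷ p) (true  ∷ q) =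
  s≤s (≤-trans (∣p∪q∣≤∣p∣+∣q∣ p q) (+-monoʳ-≤ ∣ p ∣ (n≤1+n ∣ q ∣)))
∣p∪q∣≤∣p∣+∣q∣ (true  ∷ p) (false ∷ q) = +-monoʳ-≤ 1 (∣p∪q∣≤∣p∣+∣q∣ p q)
∣p∪q∣≤∣p∣+∣q∣ (false ∷ p) (true  ∷ q) =
  ≤-trans (+-monoʳ-≤ 1 (∣p∪q∣≤∣p∣+∣q∣ p q)) (≤-reflexive (sym (+-suc ∣ p ∣ ∣ q ∣)))
∣p∪q∣≤∣p∣+∣q∣ (false ∷ p) (false ∷ q) = ∣p∪q∣≤∣p∣+∣q∣ p q

fibreSize : Bool → Subset (suc n) → Cube (suc n) → ℕ
fibreSize {n} b Y v = length (filter (λ u → inCylinder? Y v (b ∷ u)) (allPoints n))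

cylSize-∷ : (Y : Subset (suc n)) (v : Cube (suc n)) →
  cylSize Y v ≡ fibreSize false Y v + fibreSize true Y v
cylSize-∷ {n} Y v = trans
  (length-filter-++ (inCylinder? Y v) (map (false ∷_) (allPoints n)) (map (true ∷_) (allPoints n)))
  (cong₂ _+_ (length-filter-map (inCylinder? Y v) (false ∷_) (allPoints n))
             (length-filter-map (inCylinder? Y v) (true ∷_) (allPoints n)))

cylSize≤fibreSize : {b c x : Bool} → (b ≡ true → c ≡ x) → (Y : Subset n) (v : Cube n) →
  cylSize Y v ≤ fibreSize c (b ∷ Y) (x ∷ v)
cylSize≤fibreSize {n} {b} {c} {x} c≡x Y v =
  length-filter-mono (inCylinder? Y v) (λ u → inCylinder? (b ∷ Y) (x ∷ v) (c ∷ u)) extend (allPoints n)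
  where
    extend : ∀ {u} → InCylinder Y v u → InCylinder (b ∷ Y) (x ∷ v) (c ∷ u)
    extend u∈c Fin.zero    here      = c≡x refl
    extend u∈c (Fin.suc i) (there p) = u∈c i p

cylSize-free : (x : Bool) (Y : Subset n) (v : Cube n) →
  2 * cylSize Y v ≤ cylSize (false ∷ Y) (x ∷ v)
cylSize-free x Y v = begin
  cylSize Y v + (cylSize Y v + 0)  ≡⟨ cong (cylSize Y v +_) (+-identityʳ (cylSize Y v)) ⟩
  cylSize Y v + cylSize Y v        ≤⟨ +-mono-≤ (cylSize≤fibreSize (λ ()) Y v) (cylSize≤fibreSize (λ ()) Y v) ⟩
  fibreSize false (false ∷ Y) (x ∷ v) + fibreSize true (false ∷ Y) (x ∷ v)
                                   ≡⟨ cylSize-∷ (false ∷ Y) (x ∷ v) ⟨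
  cylSize (false ∷ Y) (x ∷ v)      ∎
  where open ≤-Reasoning

cylSize-fixed : (x : Bool) (Y : Subset n) (v : Cube n) →
  cylSize Y v ≤ cylSize (true ∷ Y) (x ∷ v)
cylSize-fixed x Y v = ≤-trans (fibre x) (≤-reflexive (sym (cylSize-∷ (true ∷ Y) (x ∷ v))))
  where
    fibre : (x : Bool) → cylSize Y v ≤ fibreSize false (true ∷ Y) (x ∷ v) + fibreSize true (true ∷ Y) (x ∷ v)
    fibre false = ≤-trans (cylSize≤fibreSize (λ _ → refl) Y v) (m≤m+n _ _)
    fibre true  = ≤-trans (cylSize≤fibreSize (λ _ → refl) Y v) (m≤n+m _ _)

2^n≤2^∣Y∣*cylSize : (Y : Subset n) (v : Cube n) → 2 ^ n ≤ 2 ^ ∣ Y ∣ * cylSize Y v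
2^n≤2^∣Y∣*cylSize [] [] = ≤-refl
2^n≤2^∣Y∣*cylSize {suc n} (false ∷ Y) (x ∷ v) = begin
  2 * 2 ^ n                     ≤⟨ *-monoʳ-≤ 2 (2^n≤2^∣Y∣*cylSize Y v) ⟩
  2 * (2 ^ ∣ Y ∣ * cylSize Y v)  ≡⟨ x∙yz≈y∙xz *-commutativeSemigroup 2 (2 ^ ∣ Y ∣) (cylSize Y v) ⟩
  2 ^ ∣ Y ∣ * (2 * cylSize Y v)  ≤⟨ *-monoʳ-≤ (2 ^ ∣ Y ∣) (cylSize-free x Y v) ⟩
  2 ^ ∣ Y ∣ * cylSize (false ∷ Y) (x ∷ v) ∎
  where open ≤-Reasoning
2^n≤2^∣Y∣*cylSize {suc n} (true ∷ Y) (x ∷ v) = begin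
  2 * 2 ^ n                     ≤⟨ *-monoʳ-≤ 2 (2^n≤2^∣Y∣*cylSize Y v) ⟩
  2 * (2 ^ ∣ Y ∣ * cylSize Y v)  ≡⟨ *-assoc 2 (2 ^ ∣ Y ∣) (cylSize Y v) ⟨
  2 ^ suc ∣ Y ∣ * cylSize Y v    ≤⟨ *-monoʳ-≤ (2 ^ suc ∣ Y ∣) (cylSize-fixed x Y v) ⟩
  2 ^ suc ∣ Y ∣ * cylSize (true ∷ Y) (x ∷ v) ∎
  where open ≤-Reasoning

funToFin-injective : ∀ {m k} {f g : Fin m → Fin k} → funToFin f ≡ funToFin g → f ≗ g
funToFin-injective {f = f} {g} f≡g i = begin
  f i                      ≡⟨ finToFun-funToFin f i ⟨
  finToFun (funToFin f) i  ≡⟨ cong (λ c → finToFun c i) f≡g ⟩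
  finToFun (funToFin g) i  ≡⟨ finToFun-funToFin g i ⟩
  g i                      ∎
  where open ≡-Reasoning

column : (S : List (Cube n)) → Fin n → Fin (length S) → Fin 2
column S i k = Inverse.from 2↔Bool (lookup (List.lookup S k) i)

equal-columns : {S : List (Cube n)} {i j : Fin n} →
  funToFin (column S i) ≡ funToFin (column S j) →
  (k : Fin (length S)) → lookup (List.lookup S k) i ≡ lookup (List.lookup S k) j
equal-columns {S = S} {i} {j} same k = begin
  lookup s i                   ≡⟨ strictlyInverseˡ (lookup s i) ⟨
  to (from (lookup s i))       ≡⟨ cong to (funToFin-injective same k) ⟩
  to (from (lookup s j))       ≡⟨ strictlyInverseˡ (lookup s j) ⟩
  lookup s j                   ∎
  where open ≡-Reasoning
        open Inverse 2↔Bool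
        s = List.lookup S k

cylSize-two-coordinates : (i j : Fin n) (v : Cube n) → 2 ^ n ≤ 4 * cylSize (⁅ i ⁆ ∪ ⁅ j ⁆) v
cylSize-two-coordinates i j v = ≤-trans (2^n≤2^∣Y∣*cylSize Y v) (*-monoˡ-≤ (cylSize Y v) (^-monoʳ-≤ 2 ∣Y∣≤2))
  where
    Y = ⁅ i ⁆ ∪ ⁅ j ⁆
    ∣Y∣≤2 : ∣ Y ∣ ≤ 2
    ∣Y∣≤2 = ≤-trans (∣p∪q∣≤∣p∣+∣q∣ ⁅ i ⁆ ⁅ j ⁆) (≤-reflexive (cong₂ _+_ (∣⁅x⁆∣≡1 i) (∣⁅x⁆∣≡1 j)))

-- ⁅ j ⁆ read as a point of the cube is the unit vector e_j, so the cylinder is {u | u_i = 0, u_j = 1}.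
cylinder-separates : {i j : Fin n} {u : Cube n} → i ≢ j →
  InCylinder (⁅ i ⁆ ∪ ⁅ j ⁆) ⁅ j ⁆ u → lookup u i ≢ lookup u j
cylinder-separates {i = i} {j} {u} i≢j u∈c uᵢ≡uⱼ = i≢j (x∈⁅y⁆⇒x≡y j (lookup⇒[]= i ⁅ j ⁆ eⱼ[i]≡1))
  where
    open ≡-Reasoning
    eⱼ[i]≡1 : lookup ⁅ j ⁆ i ≡ true
    eⱼ[i]≡1 = begin
      lookup ⁅ j ⁆ i  ≡⟨ u∈c i (x∈p∪q⁺ (inj₁ (x∈⁅x⁆ i))) ⟨
      lookup u i      ≡⟨ uᵢ≡uⱼ ⟩
      lookup u j      ≡⟨ u∈c j (x∈p∪q⁺ (inj₂ (x∈⁅x⁆ j))) ⟩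
      lookup ⁅ j ⁆ j  ≡⟨ []=⇒lookup (x∈⁅x⁆ j) ⟩
      true            ∎

claim1 : (n : ℕ) → 1 ≤ n → (S : List (Cube n)) → Unique S →
    WeakQuarterNet n S → n ≤ 2 ^ length S
claim1 n _ S _ net with n ≤? 2 ^ length S
... | yes n≤2^∣S∣ = n≤2^∣S∣
... | no n≰2^∣S∣
  with i , j , i<j , same ← pigeonhole (≰⇒> n≰2^∣S∣) (funToFin ∘ column S) =
  ⊥-elim (cylinder-separates {u = Any.lookup hit} (<⇒≢ᶠ i<j) (lookup-result hit)
                             (equal-columns {S = S} same (Any.index hit)))
  where
    hit : Any (InCylinder (⁅ i ⁆ ∪ ⁅ j ⁆) ⁅ j ⁆) S
    hit = net (⁅ i ⁆ ∪ ⁅ j ⁆) ⁅ j ⁆ (cylSize-two-coordinates i j ⁅ j ⁆)
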